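{- For any positive integer $n$, \[ p_1(n)\le \frac{n(n-m-1)}{2}+\frac{m(m+1)(m+2)}{12},\quad\text{where } m=\left\lfloor \frac{ -1+\sqrt{8n+1}}{2}\right\rfloor, \] and equality holds if $\frac{ -1+\sqrt{8n+1}}{2}$ is an integer.
   Context: All graphs are finite and simple. For positive integers $\ell$ and $n$, $p_\ell(n)$ denotes the maximum number of edges in an $n$-vertex graph that contains no two vertices of equal degree connected by a path of length $\ell$ (a path with $\ell$ edges on $\ell+1$ distinct vertices, the two vertices being its endpoints). In particular $p_1(n)$ is the maximum number of edges of an $n$-vertex graph with no two adjacent vertices of equal degree. -}

module Defs where

open import Data.Nat using (ℕ; zero; suc; _+_; _*_; _<ᵇ_)
open import Data.Bool using (Bool; true; false; _∧_; if_then_else_)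
open import Data.Fin using (Fin; toℕ)
open import Data.List using (List; length; filterᵇ; allFin; concatMap; map; sum)
open import Data.Product using (_×_; _,_; proj₁; proj₂)
open import Relation.Binary.PropositionalEquality using (_≡_; _≢_)

record Graph (n : ℕ) : Set where
  field
    adj    : Fin n → Fin n → Bool
    sym    : ∀ u v → adj u v ≡ adj v u
    irrefl : ∀ v → adj v v ≡ false
open Graph public

degree : ∀ {n} → Graph n → Fin n → ℕ
degree {n} G v = length (filterᵇ (adj G v) (allFin n))

edgeCount : ∀ {n} → Graph n → ℕ
edgeCount {n} G =
  length (filterᵇ (λ p → (toℕ (proj₁ p) <ᵇ toℕ (proj₂ p)) ∧ adj G (proj₁ p) (proj₂ p))
                  (concatMap (λ u → map (λ v → (u , v)) (allFin n)) (allFin n)))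

-- no two vertices of equal degree are joined by a path of length 1,
-- i.e. no two adjacent vertices have equal degree
NoAdjEqualDeg : ∀ {n} → Graph n → Set
NoAdjEqualDeg {n} G = ∀ (u v : Fin n) → adj G u v ≡ true → degree G u ≢ degree G v

-- Write c v = n ∸ deg v for the codegree. Two vertices of equal codegree have equal degree,
-- so they are not adjacent; hence the vertices of codegree t are all non-neighbours of any one
-- of them, and there are at most t of them. Consequently at most 1 + 2 + ⋯ + k vertices have
-- codegree ≤ k, and Σ_v (m + 1 ∸ c v) is at most the tetrahedral number m(m+1)(m+2)/6.
-- Together with 2e = n² − Σ_v c v and c v + (m + 1 ∸ c v) ≥ m + 1 this gives
-- 2e + n(m+1) ≤ n² + m(m+1)(m+2)/6 for every m. Equality holds for the complete
-- multipartite graph with parts of sizes 1, 2, …, m, where a vertex in a part of size k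
-- has degree n − k.

module Submission where

open import Defs hiding (sym)
open import Data.Nat.Properties
open import Algebra.Properties.CommutativeMonoid.Sum +-0-commutativeMonoid
  using (sum; sum-syntax; sum-cong-≗; ∑-distrib-+; ∑-comm; sum-replicate-zero)
open import Data.Nat using (ℕ; zero; suc; _+_; _*_; _∸_; _≤_; _<_; _<ᵇ_; _≡ᵇ_; z≤n)
open import Data.Bool using (Bool; true; false; not; _∧_; T?)
open import Data.Bool.Properties using (T-≡; ¬-not)
open import Data.Fin using (Fin; zero; suc; toℕ; _↑ˡ_; _↑ʳ_; splitAt)
open import Data.Fin.Properties using (toℕ-injective)
open import Data.List using (List; []; _∷_; length; filterᵇ; tabulate; concatMap; map)
open import Data.List.Properties using (filter-++; length-++; map-tabulate)
open import Data.Vec.Functional using (Vector; _++_; replicate)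
open import Data.Vec.Functional.Properties using (lookup-++ˡ; lookup-++ʳ)
open import Data.Product using (Σ; ∃; _×_; _,_; map₂)
open import Data.Sum using (_⊎_; inj₁; inj₂)
open import Function using (_∘_; id; Equivalence)
open import Relation.Binary using (tri<; tri≈; tri>)
open import Relation.Nullary using (¬_; contradiction)
open import Relation.Binary.PropositionalEquality
open import Data.Nat.Tactic.RingSolver using (solve; solve-∀)

-- Iverson brackets and finite sums

iverson : Bool → ℕ
iverson true  = 1
iverson false = 0

iverson≤1 : ∀ b → iverson b ≤ 1
iverson≤1 true  = ≤-refl
iverson≤1 false = z≤n

iverson-not+iverson : ∀ b → iverson (not b) + iverson b ≡ 1
iverson-not+iverson true  = refl
iverson-not+iverson false = refl

iverson+iverson≤1 : ∀ {a b} → (a ≡ true → b ≡ false) → iverson a + iverson b ≤ 1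
iverson+iverson≤1 {false} {b} _    = iverson≤1 b
iverson+iverson≤1 {true}      a⇒¬b rewrite a⇒¬b refl = ≤-refl

count : ∀ {n} → (Fin n → Bool) → ℕ
count {n} p = ∑[ i < n ] iverson (p i)

∑-const : ∀ n k → ∑[ i < n ] k ≡ n * k
∑-const zero    k = refl
∑-const (suc n) k = cong (k +_) (∑-const n k)

∑-mono-≤ : ∀ {n} {f g : Vector ℕ n} → (∀ i → f i ≤ g i) → sum f ≤ sum g
∑-mono-≤ {zero}  f≤g = z≤n
∑-mono-≤ {suc n} f≤g = +-mono-≤ (f≤g zero) (∑-mono-≤ (f≤g ∘ suc))

∑-splitAt : ∀ a b (f : Vector ℕ (a + b)) →
  sum f ≡ ∑[ i < a ] f (i ↑ˡ b) + ∑[ j < b ] f (a ↑ʳ j)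
∑-splitAt zero    b f = refl
∑-splitAt (suc a) b f = trans (cong (f zero +_) (∑-splitAt a b (f ∘ suc))) (sym (+-assoc (f zero) _ _))

count≤n : ∀ {n} (p : Fin n → Bool) → count p ≤ n
count≤n {n} p = ≤-trans (∑-mono-≤ (iverson≤1 ∘ p)) (≤-reflexive (trans (∑-const n 1) (*-identityʳ n)))

count≡0⊎∃ : ∀ {n} (p : Fin n → Bool) → count p ≡ 0 ⊎ ∃ λ i → p i ≡ true
count≡0⊎∃ {zero}  p = inj₁ refl
count≡0⊎∃ {suc n} p with p zero in p0
... | true  = inj₂ (zero , p0)
... | false with count≡0⊎∃ (p ∘ suc)
...   | inj₁ none     = inj₁ none
...   | inj₂ (i , pi) = inj₂ (suc i , pi)

∑+∑≡* : ∀ {n} {f g : Vector ℕ n} k → (∀ i → f i + g i ≡ k) → sum f + sum g ≡ n * k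
∑+∑≡* {n} {f} {g} k f+g≡k = trans (sym (∑-distrib-+ f g)) (trans (sum-cong-≗ f+g≡k) (∑-const n k))

length-filterᵇ-tabulate : ∀ {A : Set} {n} (p : A → Bool) (f : Fin n → A) →
  length (filterᵇ p (tabulate f)) ≡ ∑[ i < n ] iverson (p (f i))
length-filterᵇ-tabulate {n = zero}  p f = refl
length-filterᵇ-tabulate {n = suc n} p f with p (f zero)
... | true  = cong suc (length-filterᵇ-tabulate p (f ∘ suc))
... | false = length-filterᵇ-tabulate p (f ∘ suc)

length-filterᵇ-concatMap : ∀ {A B : Set} {n} (p : B → Bool) (g : A → List B) (f : Fin n → A) →
  length (filterᵇ p (concatMap g (tabulate f))) ≡ ∑[ i < n ] length (filterᵇ p (g (f i)))
length-filterᵇ-concatMap {n = zero}  p g f = refl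
length-filterᵇ-concatMap {n = suc n} p g f =
  trans (cong length (filter-++ (T? ∘ p) (g (f zero)) (concatMap g (tabulate (f ∘ suc)))))
        (trans (length-++ (filterᵇ p (g (f zero))))
               (cong (length (filterᵇ p (g (f zero))) +_) (length-filterᵇ-concatMap p g (f ∘ suc))))

iverson-<ᵇ-suc : ∀ x k → iverson (x <ᵇ suc k) ≡ iverson (x <ᵇ k) + iverson (x ≡ᵇ k)
iverson-<ᵇ-suc zero    zero    = refl
iverson-<ᵇ-suc zero    (suc k) = refl
iverson-<ᵇ-suc (suc x) zero    = refl
iverson-<ᵇ-suc (suc x) (suc k) = iverson-<ᵇ-suc x k

suc-∸-iverson : ∀ k x → suc k ∸ x ≡ k ∸ x + iverson (x <ᵇ suc k)
suc-∸-iverson k       zero    = +-comm 1 k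
suc-∸-iverson zero    (suc x) = 0∸n≡0 x
suc-∸-iverson (suc k) (suc x) = suc-∸-iverson k x

<ᵇ-true : ∀ {m n} → m < n → (m <ᵇ n) ≡ true
<ᵇ-true m<n = Equivalence.to T-≡ (<⇒<ᵇ m<n)

<ᵇ-false : ∀ {m n} → ¬ m < n → (m <ᵇ n) ≡ false
<ᵇ-false {m} {n} m≮n = ¬-not (m≮n ∘ <ᵇ⇒< m n ∘ Equivalence.from T-≡)

≡ᵇ≡true⇒≡ : ∀ {x y} → (x ≡ᵇ y) ≡ true → x ≡ y
≡ᵇ≡true⇒≡ {x} {y} = ≡ᵇ⇒≡ x y ∘ Equivalence.from T-≡

≡ᵇ-refl : ∀ x → (x ≡ᵇ x) ≡ true
≡ᵇ-refl x = Equivalence.to T-≡ (≡⇒≡ᵇ x x refl)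

≡ᵇ-comm : ∀ x y → (x ≡ᵇ y) ≡ (y ≡ᵇ x)
≡ᵇ-comm zero    zero    = refl
≡ᵇ-comm zero    (suc y) = refl
≡ᵇ-comm (suc x) zero    = refl
≡ᵇ-comm (suc x) (suc y) = ≡ᵇ-comm x y

iverson-≡ᵇ-* : ∀ x y (f : ℕ → ℕ) → iverson (x ≡ᵇ y) * f x ≡ iverson (x ≡ᵇ y) * f y
iverson-≡ᵇ-* zero    zero    f = refl
iverson-≡ᵇ-* zero    (suc y) f = refl
iverson-≡ᵇ-* (suc x) zero    f = refl
iverson-≡ᵇ-* (suc x) (suc y) f = iverson-≡ᵇ-* x y (f ∘ suc)

-- Triangular and tetrahedral numbers

triangle : ℕ → ℕ
triangle zero    = 0
triangle (suc k) = triangle k + suc k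

tetrahedral : ℕ → ℕ
tetrahedral zero    = 0
tetrahedral (suc k) = tetrahedral k + triangle (suc k)

2*triangle : ∀ k → 2 * triangle k ≡ k * (k + 1)
2*triangle zero    = refl
2*triangle (suc k) = begin
  2 * (triangle k + suc k)     ≡⟨ *-distribˡ-+ 2 (triangle k) (suc k) ⟩
  2 * triangle k + 2 * suc k   ≡⟨ cong (_+ 2 * suc k) (2*triangle k) ⟩
  k * (k + 1) + 2 * suc k      ≡⟨ solve (k ∷ []) ⟩
  suc k * (suc k + 1)          ∎
  where open ≡-Reasoning

6*tetrahedral : ∀ k → 6 * tetrahedral k ≡ k * (k + 1) * (k + 2)
6*tetrahedral zero    = refl
6*tetrahedral (suc k) = begin
  6 * (tetrahedral k + triangle (suc k))         ≡⟨ *-distribˡ-+ 6 (tetrahedral k) _ ⟩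
  6 * tetrahedral k + 6 * triangle (suc k)       ≡⟨ cong (6 * tetrahedral k +_) (*-assoc 3 2 (triangle (suc k))) ⟩
  6 * tetrahedral k + 3 * (2 * triangle (suc k)) ≡⟨ cong₂ (λ a b → a + 3 * b) (6*tetrahedral k) (2*triangle (suc k)) ⟩
  k * (k + 1) * (k + 2) + 3 * (suc k * (suc k + 1)) ≡⟨ solve (k ∷ []) ⟩
  suc k * (suc k + 1) * (suc k + 2)               ∎
  where open ≡-Reasoning

MultiplicityBelowValue : ∀ {n} → Vector ℕ n → Set
MultiplicityBelowValue c = ∀ t → count (λ v → c v ≡ᵇ t) ≤ t

count-<ᵇ-suc : ∀ {n} (c : Vector ℕ n) k →
  count (λ v → c v <ᵇ suc k) ≡ count (λ v → c v <ᵇ k) + count (λ v → c v ≡ᵇ k)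
count-<ᵇ-suc c k = trans (sum-cong-≗ (λ v → iverson-<ᵇ-suc (c v) k))
  (∑-distrib-+ (λ v → iverson (c v <ᵇ k)) (λ v → iverson (c v ≡ᵇ k)))

∑-suc-∸ : ∀ {n} (c : Vector ℕ n) k →
  ∑[ v < n ] (suc k ∸ c v) ≡ ∑[ v < n ] (k ∸ c v) + count (λ v → c v <ᵇ suc k)
∑-suc-∸ c k = trans (sum-cong-≗ (suc-∸-iverson k ∘ c))
  (∑-distrib-+ (λ v → k ∸ c v) (λ v → iverson (c v <ᵇ suc k)))

module _ {n} {c : Vector ℕ n} (rare : MultiplicityBelowValue c) where

  count-<ᵇ-suc≤triangle : ∀ k → count (λ v → c v <ᵇ suc k) ≤ triangle k
  count-<ᵇ-suc≤triangle zero = begin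
    count (λ v → c v <ᵇ 1)                        ≡⟨ count-<ᵇ-suc c 0 ⟩
    count (λ v → c v <ᵇ 0) + count (λ v → c v ≡ᵇ 0) ≡⟨ cong (_+ count (λ v → c v ≡ᵇ 0)) (sum-replicate-zero n) ⟩
    count (λ v → c v ≡ᵇ 0)                        ≤⟨ rare 0 ⟩
    0                                             ∎
    where open ≤-Reasoning
  count-<ᵇ-suc≤triangle (suc k) = begin
    count (λ v → c v <ᵇ suc (suc k))                        ≡⟨ count-<ᵇ-suc c (suc k) ⟩
    count (λ v → c v <ᵇ suc k) + count (λ v → c v ≡ᵇ suc k) ≤⟨ +-mono-≤ (count-<ᵇ-suc≤triangle k) (rare (suc k)) ⟩
    triangle k + suc k                                      ∎
    where open ≤-Reasoning

  ∑-suc-∸≤tetrahedral : ∀ m → ∑[ v < n ] (suc m ∸ c v) ≤ tetrahedral m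
  ∑-suc-∸≤tetrahedral zero = begin
    ∑[ v < n ] (1 ∸ c v)                           ≡⟨ ∑-suc-∸ c 0 ⟩
    ∑[ v < n ] (0 ∸ c v) + count (λ v → c v <ᵇ 1)  ≡⟨ cong (_+ count (λ v → c v <ᵇ 1)) ∑-0∸ ⟩
    count (λ v → c v <ᵇ 1)                         ≤⟨ count-<ᵇ-suc≤triangle 0 ⟩
    0                                              ∎
    where
    open ≤-Reasoning
    ∑-0∸ : ∑[ v < n ] (0 ∸ c v) ≡ 0
    ∑-0∸ = trans (sum-cong-≗ (0∸n≡0 ∘ c)) (sum-replicate-zero n)
  ∑-suc-∸≤tetrahedral (suc m) = begin
    ∑[ v < n ] (suc (suc m) ∸ c v)                                ≡⟨ ∑-suc-∸ c (suc m) ⟩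
    ∑[ v < n ] (suc m ∸ c v) + count (λ v → c v <ᵇ suc (suc m))
      ≤⟨ +-mono-≤ (∑-suc-∸≤tetrahedral m) (count-<ᵇ-suc≤triangle (suc m)) ⟩
    tetrahedral m + triangle (suc m)                              ∎
    where open ≤-Reasoning

-- Degrees, codegrees and the upper bound

module _ {n} (G : Graph n) where

  degree≡count : ∀ v → degree G v ≡ count (adj G v)
  degree≡count v = length-filterᵇ-tabulate (adj G v) id

  degree≤n : ∀ v → degree G v ≤ n
  degree≤n v = ≤-trans (≤-reflexive (degree≡count v)) (count≤n (adj G v))

  count+degree≤n : ∀ (p : Fin n → Bool) u → (∀ w → p w ≡ true → adj G u w ≡ false) →
                   count p + degree G u ≤ n
  count+degree≤n p u nonNeighbours = begin
    count p + degree G u                             ≡⟨ cong (count p +_) (degree≡count u) ⟩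
    count p + count (adj G u)                        ≡⟨ ∑-distrib-+ (iverson ∘ p) (iverson ∘ adj G u) ⟨
    ∑[ w < n ] (iverson (p w) + iverson (adj G u w)) ≤⟨ ∑-mono-≤ {n} (iverson+iverson≤1 ∘ nonNeighbours) ⟩
    ∑[ w < n ] 1                                     ≡⟨ trans (∑-const n 1) (*-identityʳ n) ⟩
    n                                                ∎
    where open ≤-Reasoning

  ascendingEdge : Fin n → Fin n → Bool
  ascendingEdge u v = (toℕ u <ᵇ toℕ v) ∧ adj G u v

  edgeCount≡∑∑ : edgeCount G ≡ ∑[ u < n ] ∑[ v < n ] iverson (ascendingEdge u v)
  edgeCount≡∑∑ = trans (length-filterᵇ-concatMap isAscending pairsFrom id) (sum-cong-≗ {n} λ u →
    trans (cong (length ∘ filterᵇ isAscending) (map-tabulate id (u ,_)))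
          (length-filterᵇ-tabulate isAscending (u ,_)))
    where
    isAscending : Fin n × Fin n → Bool
    isAscending (u , v) = ascendingEdge u v
    pairsFrom : Fin n → List (Fin n × Fin n)
    pairsFrom u = map (u ,_) (tabulate id)

  iverson-adj-split : ∀ u v → iverson (adj G u v) ≡ iverson (ascendingEdge u v) + iverson (ascendingEdge v u)
  iverson-adj-split u v with <-cmp (toℕ u) (toℕ v)
  ... | tri< u<v _ v≮u rewrite <ᵇ-true u<v | <ᵇ-false v≮u = sym (+-identityʳ _)
  ... | tri> u≮v _ v<u rewrite <ᵇ-false u≮v | <ᵇ-true v<u | Graph.sym G u v = refl
  ... | tri≈ _ u≡v _ rewrite toℕ-injective u≡v | irrefl G v | <ᵇ-false (<-irrefl {toℕ v} refl) = refl

  handshake : ∑[ v < n ] degree G v ≡ 2 * edgeCount G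
  handshake = begin
    ∑[ u < n ] degree G u                                   ≡⟨ sum-cong-≗ degree≡count ⟩
    ∑[ u < n ] ∑[ v < n ] iverson (adj G u v)
      ≡⟨ sum-cong-≗ (λ u → trans (sum-cong-≗ (iverson-adj-split u)) (∑-distrib-+ (A u) (λ v → A v u))) ⟩
    ∑[ u < n ] (∑[ v < n ] A u v + ∑[ v < n ] A v u)
      ≡⟨ ∑-distrib-+ (λ u → ∑[ v < n ] A u v) (λ u → ∑[ v < n ] A v u) ⟩
    E + ∑[ u < n ] ∑[ v < n ] A v u                         ≡⟨ cong (E +_) (∑-comm (λ v u → A v u)) ⟨
    E + E                                                   ≡⟨ cong (E +_) (+-identityʳ E) ⟨
    2 * E                                                   ≡⟨ cong (2 *_) edgeCount≡∑∑ ⟨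
    2 * edgeCount G                                         ∎
    where
    open ≡-Reasoning
    A : Fin n → Fin n → ℕ
    A u v = iverson (ascendingEdge u v)
    E : ℕ
    E = ∑[ u < n ] ∑[ v < n ] A u v

  codegree : Fin n → ℕ
  codegree v = n ∸ degree G v

  ∑degree+∑codegree : ∑[ v < n ] degree G v + ∑[ v < n ] codegree v ≡ n * n
  ∑degree+∑codegree = ∑+∑≡* n (m+[n∸m]≡n ∘ degree≤n)

  module _ (noAdjEqualDeg : NoAdjEqualDeg G) where

    codegree-multiplicityBelowValue : MultiplicityBelowValue codegree
    codegree-multiplicityBelowValue t with count≡0⊎∃ (λ w → codegree w ≡ᵇ t)
    ... | inj₁ none = ≤-trans (≤-reflexive none) z≤n
    ... | inj₂ (u , codegree-u) = begin
      count sameCodegree ≤⟨ m+n≤o⇒m≤o∸n (count sameCodegree) (count+degree≤n sameCodegree u nonNeighbours) ⟩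
      n ∸ degree G u     ≡⟨ ≡ᵇ≡true⇒≡ codegree-u ⟩
      t                  ∎
      where
      open ≤-Reasoning
      sameCodegree : Fin n → Bool
      sameCodegree w = codegree w ≡ᵇ t
      nonNeighbours : ∀ w → sameCodegree w ≡ true → adj G u w ≡ false
      nonNeighbours w codegree-w = ¬-not λ uw → noAdjEqualDeg u w uw
        (∸-cancelˡ-≡ (degree≤n u) (degree≤n w) (trans (≡ᵇ≡true⇒≡ codegree-u) (sym (≡ᵇ≡true⇒≡ codegree-w))))

    2*edgeCount+n*[1+m]≤n*n+tetrahedral : ∀ m → 2 * edgeCount G + n * suc m ≤ n * n + tetrahedral m
    2*edgeCount+n*[1+m]≤n*n+tetrahedral m = begin
      2 * edgeCount G + n * suc m
        ≡⟨ cong₂ _+_ handshake (∑-const n (suc m)) ⟨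
      D + ∑[ v < n ] suc m
        ≤⟨ +-monoʳ-≤ D (∑-mono-≤ {n} (λ v → m≤n+m∸n (suc m) (codegree v))) ⟩
      D + ∑[ v < n ] (codegree v + (suc m ∸ codegree v))
        ≡⟨ cong (D +_) (∑-distrib-+ codegree (λ v → suc m ∸ codegree v)) ⟩
      D + (∑[ v < n ] codegree v + R)
        ≡⟨ +-assoc D _ R ⟨
      D + ∑[ v < n ] codegree v + R
        ≡⟨ cong (_+ R) ∑degree+∑codegree ⟩
      n * n + R
        ≤⟨ +-monoʳ-≤ (n * n) (∑-suc-∸≤tetrahedral {c = codegree} codegree-multiplicityBelowValue m) ⟩
      n * n + tetrahedral m
        ∎
      where
      open ≤-Reasoning
      D R : ℕ
      D = ∑[ v < n ] degree G v
      R = ∑[ v < n ] (suc m ∸ codegree v)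

-- Complete multipartite graphs

completeMultipartite : ∀ {n} → Vector ℕ n → Graph n
completeMultipartite part = record
  { adj    = λ u v → not (part u ≡ᵇ part v)
  ; sym    = λ u v → cong not (≡ᵇ-comm (part u) (part v))
  ; irrefl = λ v → cong not (≡ᵇ-refl (part v))
  }

classSize : ∀ {n} → Vector ℕ n → ℕ → ℕ
classSize part k = count (λ v → k ≡ᵇ part v)

module _ {n} (part : Vector ℕ n) where

  degree+classSize : ∀ u → degree (completeMultipartite part) u + classSize part (part u) ≡ n
  degree+classSize u = begin
    degree (completeMultipartite part) u + classSize part (part u)
      ≡⟨ cong (_+ classSize part (part u)) (degree≡count (completeMultipartite part) u) ⟩
    count (λ v → not (part u ≡ᵇ part v)) + classSize part (part u)
      ≡⟨ ∑+∑≡* 1 (λ v → iverson-not+iverson (part u ≡ᵇ part v)) ⟩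
    n * 1
      ≡⟨ *-identityʳ n ⟩
    n ∎
    where open ≡-Reasoning

  completeMultipartite-noAdjEqualDeg :
    (∀ u v → classSize part (part u) ≡ classSize part (part v) → part u ≡ part v) →
    NoAdjEqualDeg (completeMultipartite part)
  completeMultipartite-noAdjEqualDeg sizesDistinct u v uv degree-u≡degree-v =
    differentParts (sizesDistinct u v (+-cancelˡ-≡ _ _ _ (begin
      degree (completeMultipartite part) u + classSize part (part u) ≡⟨ degree+classSize u ⟩
      n                                                              ≡⟨ degree+classSize v ⟨
      degree (completeMultipartite part) v + classSize part (part v) ≡⟨ cong (_+ classSize part (part v)) degree-u≡degree-v ⟨
      degree (completeMultipartite part) u + classSize part (part v) ∎)))
    where
    open ≡-Reasoning
    differentParts : part u ≢ part v
    differentParts same = contradiction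
      (trans (sym uv) (trans (cong (λ x → not (x ≡ᵇ part v)) same) (cong not (≡ᵇ-refl (part v)))))
      λ ()

-- The extremal graph

staircase : (m : ℕ) → Vector ℕ (triangle m)
staircase zero    = λ ()
staircase (suc m) = staircase m ++ replicate (suc m) m

staircase<m : ∀ m v → staircase m v < m
staircase<m (suc m) v with splitAt (triangle m) v
... | inj₁ i = m<n⇒m<1+n (staircase<m m i)
... | inj₂ _ = ≤-refl

∑-staircase : ∀ m (g : ℕ → ℕ) →
  ∑[ v < triangle (suc m) ] g (staircase (suc m) v) ≡ ∑[ v < triangle m ] g (staircase m v) + suc m * g m
∑-staircase m g = trans (∑-splitAt (triangle m) (suc m) (g ∘ staircase (suc m))) (cong₂ _+_
  (sum-cong-≗ {triangle m} (cong g ∘ lookup-++ˡ (staircase m) (replicate (suc m) m)))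
  (trans (sum-cong-≗ {suc m} (cong g ∘ lookup-++ʳ (staircase m) (replicate (suc m) m))) (∑-const (suc m) (g m))))

classSize-staircase : ∀ m k → classSize (staircase m) k ≡ iverson (k <ᵇ m) * suc k
classSize-staircase zero    k = refl
classSize-staircase (suc m) k = begin
  classSize (staircase (suc m)) k                          ≡⟨ ∑-staircase m (iverson ∘ (k ≡ᵇ_)) ⟩
  classSize (staircase m) k + suc m * iverson (k ≡ᵇ m)     ≡⟨ cong₂ _+_ (classSize-staircase m k) (*-comm (suc m) _) ⟩
  iverson (k <ᵇ m) * suc k + iverson (k ≡ᵇ m) * suc m      ≡⟨ cong (iverson (k <ᵇ m) * suc k +_) (iverson-≡ᵇ-* k m suc) ⟨
  iverson (k <ᵇ m) * suc k + iverson (k ≡ᵇ m) * suc k      ≡⟨ *-distribʳ-+ (suc k) (iverson (k <ᵇ m)) _ ⟨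
  (iverson (k <ᵇ m) + iverson (k ≡ᵇ m)) * suc k            ≡⟨ cong (_* suc k) (iverson-<ᵇ-suc k m) ⟨
  iverson (k <ᵇ suc m) * suc k                             ∎
  where open ≡-Reasoning

classSize-staircase-part : ∀ m u → classSize (staircase m) (staircase m u) ≡ suc (staircase m u)
classSize-staircase-part m u = begin
  classSize (staircase m) (staircase m u)             ≡⟨ classSize-staircase m (staircase m u) ⟩
  iverson (staircase m u <ᵇ m) * suc (staircase m u)  ≡⟨ cong (λ b → iverson b * suc (staircase m u)) (<ᵇ-true (staircase<m m u)) ⟩
  1 * suc (staircase m u)                             ≡⟨ *-identityˡ _ ⟩
  suc (staircase m u)                                 ∎
  where open ≡-Reasoning

∑-suc-staircase+tetrahedral : ∀ m → ∑[ u < triangle m ] suc (staircase m u) + tetrahedral m ≡ triangle m * suc m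
∑-suc-staircase+tetrahedral zero    = refl
∑-suc-staircase+tetrahedral (suc m) = begin
  ∑[ u < triangle (suc m) ] suc (staircase (suc m) u) + (Te + (T + suc m))
                                             ≡⟨ cong (_+ (Te + (T + suc m))) (∑-staircase m suc) ⟩
  (S + suc m * suc m) + (Te + (T + suc m))   ≡⟨ regroup S Te T (suc m) ⟩
  (S + Te) + suc m * suc m + (T + suc m)     ≡⟨ cong (λ x → x + suc m * suc m + (T + suc m)) (∑-suc-staircase+tetrahedral m) ⟩
  T * suc m + suc m * suc m + (T + suc m)    ≡⟨ expand T (suc m) ⟩
  (T + suc m) * suc (suc m)                  ∎
  where
  open ≡-Reasoning
  S Te T : ℕ
  S  = ∑[ u < triangle m ] suc (staircase m u)
  Te = tetrahedral m
  T  = triangle m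
  regroup : ∀ s te t k → s + k * k + (te + (t + k)) ≡ s + te + k * k + (t + k)
  regroup = solve-∀
  expand : ∀ t k → t * k + k * k + (t + k) ≡ (t + k) * suc k
  expand = solve-∀

staircaseGraph : ∀ m → Graph (triangle m)
staircaseGraph m = completeMultipartite (staircase m)

staircaseGraph-noAdjEqualDeg : ∀ m → NoAdjEqualDeg (staircaseGraph m)
staircaseGraph-noAdjEqualDeg m = completeMultipartite-noAdjEqualDeg (staircase m) λ u v sizes →
  suc-injective (trans (sym (classSize-staircase-part m u)) (trans sizes (classSize-staircase-part m v)))

2*edgeCount+n*[1+m]≡n*n+tetrahedral-staircase : ∀ m →
  2 * edgeCount (staircaseGraph m) + triangle m * suc m ≡ triangle m * triangle m + tetrahedral m
2*edgeCount+n*[1+m]≡n*n+tetrahedral-staircase m = begin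
  2 * edgeCount G + n * suc m                      ≡⟨ cong₂ _+_ (handshake G) (∑-suc-staircase+tetrahedral m) ⟨
  D + (∑[ u < n ] suc (staircase m u) + tetrahedral m) ≡⟨ +-assoc D _ _ ⟨
  D + ∑[ u < n ] suc (staircase m u) + tetrahedral m   ≡⟨ cong (_+ tetrahedral m) (∑+∑≡* n λ u →
                                                        trans (sym (cong (degree G u +_) (classSize-staircase-part m u)))
                                                              (degree+classSize (staircase m) u)) ⟩
  n * n + tetrahedral m                            ∎
  where
  open ≡-Reasoning
  n : ℕ
  n = triangle m
  G : Graph n
  G = staircaseGraph m
  D : ℕ
  D = ∑[ u < n ] degree G u

extremalGraph : ∀ {n} m → n ≡ triangle m →
  Σ (Graph n) λ G → NoAdjEqualDeg G × 2 * edgeCount G + n * suc m ≡ n * n + tetrahedral m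
extremalGraph m refl = staircaseGraph m , staircaseGraph-noAdjEqualDeg m , 2*edgeCount+n*[1+m]≡n*n+tetrahedral-staircase m

-- The upper bound holds for every m.
theorem4p2 : (n : ℕ) → 1 ≤ n → (m : ℕ) → m * (m + 1) ≤ 2 * n → 2 * n < (m + 1) * (m + 2) →
    ((G : Graph n) → NoAdjEqualDeg G →
      12 * edgeCount G + 6 * n * (m + 1) ≤ 6 * n * n + m * (m + 1) * (m + 2))
    × (2 * n ≡ m * (m + 1) →
      Σ (Graph n) (λ G → NoAdjEqualDeg G ×
        (12 * edgeCount G + 6 * n * (m + 1) ≡ 6 * n * n + m * (m + 1) * (m + 2))))
theorem4p2 n _ m _ _ = upper , extremal
  where
  scaleˡ : ∀ e → 6 * (2 * e + n * suc m) ≡ 12 * e + 6 * n * (m + 1)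
  scaleˡ e = solve (e ∷ n ∷ m ∷ [])
  scaleʳ : 6 * (n * n + tetrahedral m) ≡ 6 * n * n + m * (m + 1) * (m + 2)
  scaleʳ = trans (*-distribˡ-+ 6 (n * n) _) (cong₂ _+_ (sym (*-assoc 6 n n)) (6*tetrahedral m))
  upper : (G : Graph n) → NoAdjEqualDeg G →
          12 * edgeCount G + 6 * n * (m + 1) ≤ 6 * n * n + m * (m + 1) * (m + 2)
  upper G noAdjEqualDeg =
    subst₂ _≤_ (scaleˡ (edgeCount G)) scaleʳ (*-monoʳ-≤ 6 (2*edgeCount+n*[1+m]≤n*n+tetrahedral G noAdjEqualDeg m))
  extremal : 2 * n ≡ m * (m + 1) →
             Σ (Graph n) (λ G → NoAdjEqualDeg G ×
               (12 * edgeCount G + 6 * n * (m + 1) ≡ 6 * n * n + m * (m + 1) * (m + 2)))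
  extremal 2n≡m[m+1] =
    map₂ (λ {G} → map₂ λ eq → trans (sym (scaleˡ (edgeCount G))) (trans (cong (6 *_) eq) scaleʳ))
         (extremalGraph m (*-cancelˡ-≡ n (triangle m) 2 (trans 2n≡m[m+1] (sym (2*triangle m)))))
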